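{- Let $n\geq 4$, $k\geq 5$, and let $f_1^{n,k},\dots,f_n^{n,k}$ be a valid dynamic task allocation with maximum switching cost at most $2$. Let $(\vec v,\vec v_1)$ be a pair of $(s,t_1)$-adjacent demand vectors with switching cost $2$ and intermediate task $i_1$, and let $(\vec v,\vec v_2)$ be a pair of $(s,t_2)$-adjacent demand vectors with switching cost $2$ and intermediate task $i_2$. Then it is not the case that $s,i_1,t_1,i_2,t_2$ are all distinct.
   Context: A demand vector for $n$ agents and $k$ tasks is $\vec v=(v_1,\dots,v_k)$ of non-negative integers summing to $n$. A valid dynamic task allocation is a family of functions $f_1^{n,k},\dots,f_n^{n,k}$ from demand vectors to $[k]$ such that for every $\vec v$ and task $j$, exactly $v_j$ agents $a$ have $f_a^{n,k}(\vec v)=j$. The switching cost of $(\vec v,\vec v')$ is the number of agents $a$ with $f_a^{n,k}(\vec v)\neq f_a^{n,k}(\vec v')$; the maximum switching cost is its maximum over pairs at $\ell_1$ distance $2$. $(\vec v_1,\vec v_2)$ is $(s,t)$-adjacent if $\vec v_2$ is obtained from $\vec v_1$ by moving one unit of demand from task $s$ to task $t\neq s$. Agent $a$ is $(i,j)$-mobile for $(\vec v_1,\vec v_2)$ if $f_a^{n,k}(\vec v_1)=i\neq j=f_a^{n,k}(\vec v_2)$. If $(\vec v_1,\vec v_2)$ is $(s,t)$-adjacent with switching cost $2$, its intermediate task is the task $i$ such that one agent is $(s,i)$-mobile and another is $(i,t)$-mobile. -}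

module Defs where

open import Data.Nat using (ℕ; zero; suc; _+_; _≤_; ∣_-_∣)
open import Data.Fin using (Fin; zero; suc; _≟_)
open import Data.Product using (Σ; ∃; ∃-syntax; _×_; _,_; proj₁)
open import Relation.Nullary using (¬_; yes; no)

open import Relation.Nullary.Decidable using (Dec; ¬?)
open import Relation.Binary.PropositionalEquality using (_≡_; _≢_)

Σ[_] : {m : ℕ} → (Fin m → ℕ) → ℕ
Σ[_] {zero}  g = 0
Σ[_] {suc m} g = g zero + Σ[_] (λ i → g (suc i))

count : {m : ℕ} {P : Fin m → Set} → ((i : Fin m) → Dec (P i)) → ℕ
count {zero} d = 0
count {suc m} d with d zero
... | yes _ = suc (count (λ i → d (suc i)))
... | no  _ = count (λ i → d (suc i))

DemandVec : ℕ → ℕ → Set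
DemandVec n k = Σ (Fin k → ℕ) (λ v → Σ[ v ] ≡ n)

Allocation : ℕ → ℕ → Set
Allocation n k = Fin n → DemandVec n k → Fin k

Valid : {n k : ℕ} → Allocation n k → Set
Valid {n} {k} f = (v : DemandVec n k) (j : Fin k) →
  count (λ a → f a v ≟ j) ≡ proj₁ v j

l1dist : {n k : ℕ} → DemandVec n k → DemandVec n k → ℕ
l1dist (v , _) (w , _) = Σ[ (λ j → ∣ v j - w j ∣) ]

switchingCost : {n k : ℕ} → Allocation n k → DemandVec n k → DemandVec n k → ℕ
switchingCost f v w = count (λ a → ¬? (f a v ≟ f a w))

MaxSwitchingCostAtMost : {n k : ℕ} → Allocation n k → ℕ → Set
MaxSwitchingCostAtMost {n} {k} f c = (v w : DemandVec n k) →
  l1dist v w ≡ 2 → switchingCost f v w ≤ c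

Adjacent : {n k : ℕ} → Fin k → Fin k → DemandVec n k → DemandVec n k → Set
Adjacent {n} {k} s t (v₁ , _) (v₂ , _) =
  s ≢ t × v₁ s ≡ suc (v₂ s) × v₂ t ≡ suc (v₁ t) ×
  ((j : Fin k) → j ≢ s → j ≢ t → v₂ j ≡ v₁ j)

Mobile : {n k : ℕ} → Allocation n k → Fin n → Fin k → Fin k →
         DemandVec n k → DemandVec n k → Set
Mobile f a i j v₁ v₂ = f a v₁ ≡ i × i ≢ j × f a v₂ ≡ j

IntermediateTask : {n k : ℕ} → Allocation n k → Fin k → Fin k → Fin k →
                   DemandVec n k → DemandVec n k → Set
IntermediateTask {n} f s t i v₁ v₂ =
  Σ (Fin n) λ a → Σ (Fin n) λ b →
    a ≢ b × Mobile f a s i v₁ v₂ × Mobile f b i t v₁ v₂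

-- Both v₁ and v₂ arise from v by moving a unit of demand out of s, so they are at ℓ₁
-- distance 2 from each other.  Since a pair of switching cost 2 moves exactly its two
-- mobile agents, every other agent keeps its task.  Tracking the (s,i₁)- and
-- (i₁,t₁)-mobile agents of (v,v₁) and the (i₂,t₂)-mobile agent of (v,v₂), one finds
-- three distinct agents whose tasks differ between v₁ and v₂ when the five tasks are
-- distinct, contradicting the bound 2 on the switching cost of (v₁,v₂).
module Submission where

open import Defs
open import Data.Nat using (ℕ; _≤_; zero; suc; _+_; ∣_-_∣; z≤n; s≤s)
open import Data.Nat.Properties
  using ( module ≤-Reasoning; ≤-reflexive; m≤n⇒m≤1+n; ≤⇒≯; +-comm; +-identityʳ
        ; ∣-∣-comm; ∣m-m+n∣≡n; m≡n⇒∣m-n∣≡0)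
  renaming (suc-injective to ℕ-suc-injective)
open import Data.Fin using (Fin; zero; suc; _≟_)
open import Data.Fin.Properties using (suc-injective)
open import Data.Product using (_×_; _,_; proj₁)
open import Data.Empty using (⊥-elim)
open import Function using (_∘_)
open import Relation.Nullary using (¬_; yes; no; Dec)
open import Relation.Nullary.Decidable using (¬?; _×-dec_)
open import Relation.Binary.PropositionalEquality
  using (_≡_; _≢_; refl; sym; trans; cong; cong₂; module ≡-Reasoning)

private
  variable
    m : ℕ
    P Q : Fin m → Set

count-mono : (d : ∀ i → Dec (P i)) (e : ∀ i → Dec (Q i)) →
             (∀ i → P i → Q i) → count d ≤ count e
count-mono {zero}  d e P⇒Q = z≤n
count-mono {suc m} d e P⇒Q with d zero | e zero
... | yes _  | yes _  = s≤s (count-mono (d ∘ suc) (e ∘ suc) (P⇒Q ∘ suc))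
... | yes p  | no ¬q  = ⊥-elim (¬q (P⇒Q zero p))
... | no _   | yes _  = m≤n⇒m≤1+n (count-mono (d ∘ suc) (e ∘ suc) (P⇒Q ∘ suc))
... | no _   | no _   = count-mono (d ∘ suc) (e ∘ suc) (P⇒Q ∘ suc)

count-remove : (d : ∀ i → Dec (P i)) (e : ∀ i → Dec (Q i)) → (∀ i → Q i → P i) →
               {a : Fin m} → P a → ¬ Q a → suc (count e) ≤ count d
count-remove {suc m} d e Q⇒P {zero} pa ¬qa with d zero | e zero
... | yes _  | no _  = s≤s (count-mono (e ∘ suc) (d ∘ suc) (Q⇒P ∘ suc))
... | no ¬pa | _     = ⊥-elim (¬pa pa)
... | _      | yes q = ⊥-elim (¬qa q)
count-remove {suc m} d e Q⇒P {suc a} pa ¬qa with d zero | e zero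
... | yes _  | yes _ = s≤s (count-remove (d ∘ suc) (e ∘ suc) (Q⇒P ∘ suc) pa ¬qa)
... | yes _  | no _  = m≤n⇒m≤1+n (count-remove (d ∘ suc) (e ∘ suc) (Q⇒P ∘ suc) pa ¬qa)
... | no ¬p  | yes q = ⊥-elim (¬p (Q⇒P zero q))
... | no _   | no _  = count-remove (d ∘ suc) (e ∘ suc) (Q⇒P ∘ suc) pa ¬qa

count-≥3 : (d : ∀ i → Dec (P i)) {a b c : Fin m} → a ≢ b → a ≢ c → b ≢ c →
           P a → P b → P c → 3 ≤ count d
count-≥3 {P = P} d {a} {b} {c} a≢b a≢c b≢c pa pb pc = begin
  3                  ≤⟨ s≤s (s≤s (s≤s z≤n)) ⟩
  3 + count d-abc    ≤⟨ s≤s (s≤s without-c) ⟩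
  2 + count d-ab     ≤⟨ s≤s without-b ⟩
  1 + count d-a      ≤⟨ without-a ⟩
  count d            ∎
  where
  open ≤-Reasoning
  d-a : ∀ i → Dec (P i × i ≢ a)
  d-a i = d i ×-dec ¬? (i ≟ a)
  d-ab : ∀ i → Dec (P i × i ≢ a × i ≢ b)
  d-ab i = d i ×-dec ¬? (i ≟ a) ×-dec ¬? (i ≟ b)
  d-abc : ∀ i → Dec (P i × i ≢ a × i ≢ b × i ≢ c)
  d-abc i = d i ×-dec ¬? (i ≟ a) ×-dec ¬? (i ≟ b) ×-dec ¬? (i ≟ c)
  without-a : 1 + count d-a ≤ count d
  without-a = count-remove d d-a (λ _ → proj₁) pa (λ (_ , a≢a) → a≢a refl)
  without-b : 1 + count d-ab ≤ count d-a
  without-b = count-remove d-a d-ab (λ _ (p , a≢i , _) → p , a≢i)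
                           (pb , a≢b ∘ sym) (λ (_ , _ , b≢b) → b≢b refl)
  without-c : 1 + count d-abc ≤ count d-ab
  without-c = count-remove d-ab d-abc (λ _ (p , a≢i , b≢i , _) → p , a≢i , b≢i)
                           (pc , a≢c ∘ sym , b≢c ∘ sym) (λ (_ , _ , _ , c≢c) → c≢c refl)

Σ-zero : (g : Fin m → ℕ) → (∀ j → g j ≡ 0) → Σ[ g ] ≡ 0
Σ-zero {zero}  g g≡0 = refl
Σ-zero {suc m} g g≡0 = cong₂ _+_ (g≡0 zero) (Σ-zero (g ∘ suc) (g≡0 ∘ suc))

Σ-single : (g : Fin m → ℕ) (a : Fin m) → (∀ j → j ≢ a → g j ≡ 0) → Σ[ g ] ≡ g a
Σ-single {suc m} g zero    g≡0 =
  trans (cong (g zero +_) (Σ-zero (g ∘ suc) (λ j → g≡0 (suc j) λ ()))) (+-identityʳ (g zero))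
Σ-single {suc m} g (suc a) g≡0 =
  cong₂ _+_ (g≡0 zero λ ()) (Σ-single (g ∘ suc) a (λ j j≢a → g≡0 (suc j) (j≢a ∘ suc-injective)))

Σ-pair : (g : Fin m → ℕ) {a b : Fin m} → a ≢ b →
         (∀ j → j ≢ a → j ≢ b → g j ≡ 0) → Σ[ g ] ≡ g a + g b
Σ-pair g {zero}  {zero}  a≢b g≡0 = ⊥-elim (a≢b refl)
Σ-pair {suc m} g {zero}  {suc b} a≢b g≡0 =
  cong (g zero +_) (Σ-single (g ∘ suc) b (λ j j≢b → g≡0 (suc j) (λ ()) (j≢b ∘ suc-injective)))
Σ-pair {suc m} g {suc a} {zero}  a≢b g≡0 =
  trans (cong (g zero +_) (Σ-single (g ∘ suc) a (λ j j≢a → g≡0 (suc j) (j≢a ∘ suc-injective) (λ ()))))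
        (+-comm (g zero) (g (suc a)))
Σ-pair {suc m} g {suc a} {suc b} a≢b g≡0 =
  cong₂ _+_ (g≡0 zero (λ ()) (λ ()))
            (Σ-pair (g ∘ suc) (a≢b ∘ cong suc)
                    (λ j j≢a j≢b → g≡0 (suc j) (j≢a ∘ suc-injective) (j≢b ∘ suc-injective)))

∣n-1+n∣≡1 : ∀ n → ∣ n - suc n ∣ ≡ 1
∣n-1+n∣≡1 n = trans (cong ∣ n -_∣ (+-comm 1 n)) (∣m-m+n∣≡n n 1)

∣1+n-n∣≡1 : ∀ n → ∣ suc n - n ∣ ≡ 1
∣1+n-n∣≡1 n = trans (∣-∣-comm (suc n) n) (∣n-1+n∣≡1 n)

l1dist-common-source : {n k : ℕ} {s t₁ t₂ : Fin k} {v v₁ v₂ : DemandVec n k} →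
  t₁ ≢ t₂ → Adjacent s t₁ v v₁ → Adjacent s t₂ v v₂ → l1dist v₁ v₂ ≡ 2
l1dist-common-source {s = s} {t₁} {t₂} {v , _} {w₁ , _} {w₂ , _} t₁≢t₂
  (s≢t₁ , w₁s , w₁t₁ , w₁-rest) (s≢t₂ , w₂s , w₂t₂ , w₂-rest) =
  begin
    Σ[ (λ j → ∣ w₁ j - w₂ j ∣) ]            ≡⟨ Σ-pair _ t₁≢t₂ unchanged ⟩
    ∣ w₁ t₁ - w₂ t₁ ∣ + ∣ w₁ t₂ - w₂ t₂ ∣  ≡⟨ cong₂ _+_ diff-t₁ diff-t₂ ⟩
    2                                     ∎
  where
  open ≡-Reasoning
  diff-t₁ : ∣ w₁ t₁ - w₂ t₁ ∣ ≡ 1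
  diff-t₁ = trans (cong₂ ∣_-_∣ w₁t₁ (w₂-rest t₁ (s≢t₁ ∘ sym) t₁≢t₂)) (∣1+n-n∣≡1 (v t₁))
  diff-t₂ : ∣ w₁ t₂ - w₂ t₂ ∣ ≡ 1
  diff-t₂ = trans (cong₂ ∣_-_∣ (w₁-rest t₂ (s≢t₂ ∘ sym) (t₁≢t₂ ∘ sym)) w₂t₂) (∣n-1+n∣≡1 (v t₂))
  unchanged : ∀ j → j ≢ t₁ → j ≢ t₂ → ∣ w₁ j - w₂ j ∣ ≡ 0
  unchanged j j≢t₁ j≢t₂ with j ≟ s
  ... | yes refl = m≡n⇒∣m-n∣≡0 (ℕ-suc-injective (trans (sym w₁s) w₂s))
  ... | no j≢s   = m≡n⇒∣m-n∣≡0 (trans (w₁-rest j j≢s j≢t₁) (sym (w₂-rest j j≢s j≢t₂)))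

module _ {n k : ℕ} (f : Allocation n k) where

  Moves : Fin n → DemandVec n k → DemandVec n k → Set
  Moves a v w = f a v ≢ f a w

  Mobile⇒Moves : ∀ {a i j v w} → Mobile f a i j v w → Moves a v w
  Mobile⇒Moves (refl , i≢j , refl) = i≢j

  three-movers⇒3≤switchingCost : ∀ {a b c v w} → a ≢ b → a ≢ c → b ≢ c →
    Moves a v w → Moves b v w → Moves c v w → 3 ≤ switchingCost f v w
  three-movers⇒3≤switchingCost {v = v} {w} = count-≥3 (λ a → ¬? (f a v ≟ f a w))

  others-stay : ∀ {a b x v w} → switchingCost f v w ≤ 2 → a ≢ b →
    Moves a v w → Moves b v w → x ≢ a → x ≢ b → f x v ≡ f x w
  others-stay {a} {b} {x} {v} {w} cost≤2 a≢b a-moves b-moves x≢a x≢b with f x v ≟ f x w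
  ... | yes stays = stays
  ... | no x-moves = ⊥-elim (≤⇒≯ cost≤2
          (three-movers⇒3≤switchingCost a≢b (x≢a ∘ sym) (x≢b ∘ sym) a-moves b-moves x-moves))

lemma19 : (n k : ℕ) → 4 ≤ n → 5 ≤ k →
    (f : Allocation n k) → Valid f → MaxSwitchingCostAtMost f 2 →
    (s t₁ t₂ i₁ i₂ : Fin k) (v v₁ v₂ : DemandVec n k) →
    Adjacent s t₁ v v₁ → switchingCost f v v₁ ≡ 2 → IntermediateTask f s t₁ i₁ v v₁ →
    Adjacent s t₂ v v₂ → switchingCost f v v₂ ≡ 2 → IntermediateTask f s t₂ i₂ v v₂ →
    ¬ (s ≢ i₁ × s ≢ t₁ × s ≢ i₂ × s ≢ t₂ × i₁ ≢ t₁ × i₁ ≢ i₂ × i₁ ≢ t₂ ×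
    t₁ ≢ i₂ × t₁ ≢ t₂ × i₂ ≢ t₂)
lemma19 n k _ _ f _ max-cost s t₁ t₂ i₁ i₂ v v₁ v₂
  adj₁ cost₁ (a , b , a≢b , a-mob@(av , _ , av₁) , b-mob@(bv , _ , bv₁))
  adj₂ cost₂ (c , d , c≢d , c-mob@(cv , _ , cv₂) , d-mob@(dv , _ , dv₂))
  (s≢i₁ , _ , s≢i₂ , _ , i₁≢t₁ , i₁≢i₂ , _ , _ , t₁≢t₂ , i₂≢t₂) =
  ≤⇒≯ (max-cost v₁ v₂ (l1dist-common-source {v = v} {v₁} {v₂} t₁≢t₂ adj₁ adj₂))
      (three-movers⇒3≤switchingCost f a≢b a≢d b≢d a-moves b-moves d-moves)
  where
  apart : ∀ {x y i j} → f x v ≡ i → f y v ≡ j → i ≢ j → x ≢ y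
  apart fx fy i≢j refl = i≢j (trans (sym fx) fy)
  a≢d : a ≢ d
  a≢d = apart av dv s≢i₂
  b≢d : b ≢ d
  b≢d = apart bv dv i₁≢i₂
  stays₁ : ∀ {x} → x ≢ a → x ≢ b → f x v ≡ f x v₁
  stays₁ = others-stay f (≤-reflexive cost₁) a≢b (Mobile⇒Moves f a-mob) (Mobile⇒Moves f b-mob)
  stays₂ : ∀ {x} → x ≢ c → x ≢ d → f x v ≡ f x v₂
  stays₂ = others-stay f (≤-reflexive cost₂) c≢d (Mobile⇒Moves f c-mob) (Mobile⇒Moves f d-mob)
  b-moves : Moves f b v₁ v₂
  b-moves eq = i₁≢t₁ (trans (sym bv) (trans (stays₂ (apart bv cv (s≢i₁ ∘ sym)) b≢d) (trans (sym eq) bv₁)))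
  d-moves : Moves f d v₁ v₂
  d-moves eq = i₂≢t₂ (trans (sym dv) (trans (stays₁ (a≢d ∘ sym) (b≢d ∘ sym)) (trans eq dv₂)))
  a-moves : Moves f a v₁ v₂
  a-moves eq with a ≟ c
  ... | yes refl = i₁≢i₂ (trans (sym av₁) (trans eq cv₂))
  ... | no a≢c   = s≢i₁ (trans (sym av) (trans (stays₂ a≢c a≢d) (trans (sym eq) av₁)))
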